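{- Let $T$ be an $(r\times c, v)$-near triple array with $v\ge rc - c\cdot\min(r,c-1)/2$, and let $T'$ be the $r\times(c+1)$ array on $v+r$ symbols obtained from $T$ by appending a new column filled with $r$ new symbols (distinct from each other and from the symbols of $T$). Then $T'$ is an $(r\times(c+1), v+r)$-near triple array.
   Context: An $r\times c$ row-column design on $v$ symbols is an $r\times c$ array each of whose cells is filled with one of $v$ symbols. It is binary if no symbol occurs more than once in any row or in any column. Let $e=rc/v$, $e^-=\lfloor e\rfloor$, $e^+=\lceil e\rceil$. The design is equireplicate if $e$ is an integer and every symbol occurs exactly $e$ times, and near equireplicate if $e$ is not an integer and every symbol occurs $e^-$ or $e^+$ times. For a binary design with $r,c\ge2$, let $R_i$, $C_j$ be the symbol sets of row $i$ and column $j$, and put $\lambda_{rc}=\frac{1}{rc}\sum_{i,j}|R_i\cap C_j|$, $\lambda_{rr}=\binom{r}{2}^{ -1}\sum_{i<j}|R_i\cap R_j|$, $\lambda_{cc}=\binom{c}{2}^{ -1}\sum_{i<j}|C_i\cap C_j|$; for real $x$, $x^-=\lfloor x\rfloor$, $x^+=\lceil x\rceil$. An $(r\times c,v)$-near triple array is a binary $r\times c$ row-column design on $v$ symbols which is equireplicate or near equireplicate and in which every row and column share $\lambda_{rc}^-$ or $\lambda_{rc}^+$ symbols, every two distinct rows share $\lambda_{rr}^-$ or $\lambda_{rr}^+$ symbols, and every two distinct columns share $\lambda_{cc}^-$ or $\lambda_{cc}^+$ symbols. -}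

module Defs where

open import Data.Nat using (ℕ; zero; suc; _+_; _*_; _≤_; _/_; _<?_)
open import Data.Nat.Combinatorics using (_C_)
open import Data.Fin using (Fin; toℕ; _↑ˡ_; _↑ʳ_; splitAt)
open import Data.Fin.Properties using (_≟_)
open import Data.List using (List; map; allFin)
open import Data.Nat.ListAction using (sum)
open import Data.Bool.ListAction using (any)
open import Data.Bool using (Bool; true; false; if_then_else_; _∧_)
open import Data.Sum using (_⊎_; [_,_]′)
open import Data.Product using (_×_)
open import Relation.Nullary.Decidable using (⌊_⌋)
open import Relation.Binary.PropositionalEquality using (_≡_; _≢_)

Design : ℕ → ℕ → ℕ → Set
Design r c v = Fin r → Fin c → Fin v

#_ : ∀ {n} → (Fin n → Bool) → ℕ
#_ {n} p = sum (map (λ k → if p k then 1 else 0) (allFin n))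

occurs : ∀ {n v} → (Fin n → Fin v) → Fin v → Bool
occurs {n} f s = any (λ k → ⌊ f k ≟ s ⌋) (allFin n)

Σ[_] : ∀ {n} → (Fin n → ℕ) → ℕ
Σ[_] {n} f = sum (map f (allFin n))

-- floor and ceiling of N / D (D ≠ 0 in all uses; value 0 when D = 0)
floorDiv : ℕ → ℕ → ℕ
floorDiv n zero = 0
floorDiv n (suc d) = n / suc d

ceilDiv : ℕ → ℕ → ℕ
ceilDiv n zero = 0
ceilDiv n (suc d) = (n + d) / suc d

FloorOrCeil : ℕ → ℕ → ℕ → Set
FloorOrCeil k N D = (k ≡ floorDiv N D) ⊎ (k ≡ ceilDiv N D)

module _ {r c v : ℕ} (T : Design r c v) where
  Row : Fin r → Fin v → Bool
  Row i = occurs (T i)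

  Col : Fin c → Fin v → Bool
  Col j = occurs (λ i → T i j)

  repl : Fin v → ℕ
  repl s = Σ[ (λ i → # (λ j → ⌊ T i j ≟ s ⌋)) ]

  rowCol : Fin r → Fin c → ℕ
  rowCol i j = # (λ s → Row i s ∧ Col j s)

  rowRow : Fin r → Fin r → ℕ
  rowRow i i' = # (λ s → Row i s ∧ Row i' s)

  colCol : Fin c → Fin c → ℕ
  colCol j j' = # (λ s → Col j s ∧ Col j' s)

  -- numerators of λ_rc, λ_rr, λ_cc (denominators rc, C(r,2), C(c,2))
  sumRC : ℕ
  sumRC = Σ[ (λ i → Σ[ (λ j → rowCol i j) ]) ]

  sumRR : ℕ
  sumRR = Σ[ (λ i → Σ[ (λ i' → if ⌊ toℕ i <? toℕ i' ⌋ then rowRow i i' else 0) ]) ]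

  sumCC : ℕ
  sumCC = Σ[ (λ j → Σ[ (λ j' → if ⌊ toℕ j <? toℕ j' ⌋ then colCol j j' else 0) ]) ]

  Binary : Set
  Binary = (∀ i j j' → T i j ≡ T i j' → j ≡ j')
         × (∀ i i' j → T i j ≡ T i' j → i ≡ i')

-- The (near) equireplicate condition is
-- "every symbol occurs e⁻ or e⁺ times", e = rc/v; when e is an integer
-- e⁻ = e⁺ = e, so this also covers the equireplicate case.
record NearTripleArray (r c v : ℕ) (T : Design r c v) : Set where
  field
    r≥2 : 2 ≤ r
    c≥2 : 2 ≤ c
    binary : Binary T
    replication : ∀ s → FloorOrCeil (repl T s) (r * c) v
    rowColBal : ∀ i j → FloorOrCeil (rowCol T i j) (sumRC T) (r * c)
    rowRowBal : ∀ i i' → i ≢ i' → FloorOrCeil (rowRow T i i') (sumRR T) (r C 2)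
    colColBal : ∀ j j' → j ≢ j' → FloorOrCeil (colCol T j j') (sumCC T) (c C 2)

appendColumn : ∀ {r c v} → Design r c v → Design r (c + 1) (v + r)
appendColumn {r} {c} {v} T i j =
  [ (λ j' → T i j' ↑ˡ r) , (λ _ → v ↑ʳ i) ]′ (splitAt c j)

{-# OPTIONS --safe #-}
module Submission where

-- For a binary design, a symbol s of replication e_s lies in exactly e_s rows and e_s
-- columns, so Σ |R_i ∩ C_j| = Σ e_s² and Σ_{i<i'} |R_i ∩ R_i'| = Σ_{j<j'} |C_j ∩ C_j'|
-- = Σ C(e_s, 2).  Appending a column of r fresh symbols (each of replication 1) therefore
-- adds r to the numerator of λ_rc and nothing to those of λ_rr and λ_cc; old intersection
-- numbers are unchanged, a row meets the new column in 1 symbol and an old column meets it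
-- in none.  Being ⌊N/D⌋ or ⌈N/D⌉ is the linear condition |N − kD| < D, which survives
-- passing to the mediant (N + A)/(D + E) as soon as |A − kE| ≤ E.  The hypothesis on v
-- gives rc ≤ 2v, hence e_s ≤ 2 and λ_rc ≤ 2, and Σ C(e_s, 2) ≤ C(c, 2), hence λ_cc ≤ 1;
-- these bounds are exactly what the mediant step needs.

open import Defs
open import Data.Bool using (Bool; true; false; if_then_else_; _∧_)
open import Data.Bool.Properties using (∧-zeroʳ; ∧-identityʳ; ∧-comm)
open import Data.Empty using (⊥-elim)
open import Data.Fin using (Fin; zero; suc; toℕ; fromℕ<; _↑ˡ_; _↑ʳ_; splitAt; punchIn)
open import Data.Fin.Properties
  using (_≟_; toℕ<n; punchInᵢ≢i; ↑ˡ-injective; ↑ʳ-injective; splitAt-↑ˡ; splitAt-↑ʳ; join-splitAt)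
open import Data.List using (tabulate)
open import Data.List.Properties using (map-tabulate)
open import Data.List.Relation.Unary.Any.Properties using (any⁺; any⁻; tabulate⁺; tabulate⁻)
open import Data.Nat
  using (ℕ; zero; suc; _+_; _*_; _∸_; _⊓_; _/_; _%_; _≤_; _<_; _≤?_; _<?_; z≤n; s≤s; z<s; s<s; s≤s⁻¹; s<s⁻¹; NonZero)
open import Data.Nat.Combinatorics using (_C_; nC1≡n; nCk+nC[k+1]≡[n+1]C[k+1])
open import Data.Nat.DivMod using (m/n*n≤m; m≡m%n+[m/n]*n; m%n<n; m<n*o⇒m/o<n; /-monoˡ-≤; m*n/n≡m)
open import Data.Nat.ListAction as List using ()
open import Data.Nat.Properties hiding (_≟_)
open import Data.Nat.Tactic.RingSolver using (solve-∀)
open import Data.Product using (∃-syntax; _×_; _,_; proj₁; proj₂)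
open import Data.Sum using (inj₁; inj₂)
open import Function using (id; _∘_; _⇔_; mk⇔)
open import Relation.Nullary using (¬_; yes; no; contradiction)
open import Relation.Nullary.Decidable
  using (Dec; ⌊_⌋; toWitness; fromWitness; dec-true; dec-false; does-⇔; isYes≗does)
open import Relation.Nullary.Reflects using (Reflects; ofʸ; ofⁿ; fromEquivalence; det)
open import Relation.Binary.PropositionalEquality
open import Algebra.Properties.CommutativeSemigroup +-commutativeSemigroup using (interchange)
open import Algebra.Properties.Semiring.Sum +-*-semiring
  using (sum; sum-syntax; sum-cong-≗; sum-remove; sum-replicate-zero; ∑-comm; ∑-distrib-+;
         *-distribˡ-sum; *-distribʳ-sum)

⌊⌋-true : ∀ {a} {A : Set a} (a? : Dec A) → A → ⌊ a? ⌋ ≡ true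
⌊⌋-true a? a = trans (isYes≗does a?) (dec-true a? a)

⌊⌋-false : ∀ {a} {A : Set a} (a? : Dec A) → ¬ A → ⌊ a? ⌋ ≡ false
⌊⌋-false a? ¬a = trans (isYes≗does a?) (dec-false a? ¬a)

⌊⌋-⇔ : ∀ {a b} {A : Set a} {B : Set b} → A ⇔ B → (a? : Dec A) (b? : Dec B) → ⌊ a? ⌋ ≡ ⌊ b? ⌋
⌊⌋-⇔ A⇔B a? b? = trans (isYes≗does a?) (trans (does-⇔ A⇔B a? b?) (sym (isYes≗does b?)))

𝟙 : Bool → ℕ
𝟙 b = if b then 1 else 0

𝟙-∧ : ∀ a b → 𝟙 (a ∧ b) ≡ 𝟙 a * 𝟙 b
𝟙-∧ true  b = sym (+-identityʳ (𝟙 b))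
𝟙-∧ false b = refl

if-then-0 : ∀ b x → (if b then x else 0) ≡ 𝟙 b * x
if-then-0 true  x = sym (+-identityʳ x)
if-then-0 false x = refl

<?-suc : ∀ m n → ⌊ suc m <? suc n ⌋ ≡ ⌊ m <? n ⌋
<?-suc m n = ⌊⌋-⇔ (mk⇔ s<s⁻¹ s<s) (suc m <? suc n) (m <? n)

-- Finite sums and counting

Σ≡sum : ∀ {n} (f : Fin n → ℕ) → Σ[ f ] ≡ sum f
Σ≡sum f = trans (cong List.sum (map-tabulate id f)) (sum-tabulate f)
  where
  sum-tabulate : ∀ {m} (g : Fin m → ℕ) → List.sum (tabulate g) ≡ sum g
  sum-tabulate {zero}  g = refl
  sum-tabulate {suc m} g = cong (g zero +_) (sum-tabulate (g ∘ suc))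

Σ²≡sum² : ∀ {m n} (f : Fin m → Fin n → ℕ) → Σ[ (λ i → Σ[ f i ]) ] ≡ sum (λ i → sum (f i))
Σ²≡sum² f = trans (Σ≡sum (λ i → Σ[ f i ])) (sum-cong-≗ (λ i → Σ≡sum (f i)))

sum-↑ : ∀ m {n} (f : Fin (m + n) → ℕ) → sum f ≡ sum (f ∘ (_↑ˡ n)) + sum (f ∘ (m ↑ʳ_))
sum-↑ zero    f = refl
sum-↑ (suc m) f = trans (cong (f zero +_) (sum-↑ m (f ∘ suc))) (sym (+-assoc (f zero) _ _))

sum-const : ∀ n x → sum {n} (λ _ → x) ≡ n * x
sum-const zero    x = refl
sum-const (suc n) x = cong (x +_) (sum-const n x)

sum-mono-≤ : ∀ {n} {f g : Fin n → ℕ} → (∀ k → f k ≤ g k) → sum f ≤ sum g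
sum-mono-≤ {zero}  _   = z≤n
sum-mono-≤ {suc n} f≤g = +-mono-≤ (f≤g zero) (sum-mono-≤ (f≤g ∘ suc))

#≡sum : ∀ {n} (p : Fin n → Bool) → # p ≡ sum (𝟙 ∘ p)
#≡sum p = Σ≡sum (𝟙 ∘ p)

#-cong : ∀ {n} {p q : Fin n → Bool} → (∀ k → p k ≡ q k) → # p ≡ # q
#-cong {p = p} {q} p≗q = trans (#≡sum p) (trans (sum-cong-≗ (cong 𝟙 ∘ p≗q)) (sym (#≡sum q)))

#-none : ∀ {n} (p : Fin n → Bool) → (∀ k → p k ≡ false) → # p ≡ 0
#-none {n} p none = trans (#≡sum p) (trans (sum-cong-≗ (cong 𝟙 ∘ none)) (sum-replicate-zero n))

#-≟ : ∀ {n} (t : Fin n) → # (λ k → ⌊ k ≟ t ⌋) ≡ 1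
#-≟ {suc n} t = begin
  # p                                ≡⟨ #≡sum p ⟩
  sum (𝟙 ∘ p)                        ≡⟨ sum-remove {i = t} (𝟙 ∘ p) ⟩
  𝟙 (p t) + sum (𝟙 ∘ p ∘ punchIn t)  ≡⟨ cong₂ _+_ (cong 𝟙 (⌊⌋-true (t ≟ t) refl)) (sym (#≡sum (p ∘ punchIn t))) ⟩
  1 + # (p ∘ punchIn t)              ≡⟨ cong (1 +_) (#-none (p ∘ punchIn t) elsewhere) ⟩
  1                                  ∎
  where
  open ≡-Reasoning
  p : Fin (suc n) → Bool
  p k = ⌊ k ≟ t ⌋
  elsewhere : ∀ k → p (punchIn t k) ≡ false
  elsewhere k = ⌊⌋-false (punchIn t k ≟ t) (punchInᵢ≢i t k)

#-≟′ : ∀ {n} (t : Fin n) → # (λ k → ⌊ t ≟ k ⌋) ≡ 1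
#-≟′ t = trans (#-cong λ k → ⌊⌋-⇔ (mk⇔ sym sym) (t ≟ k) (k ≟ t)) (#-≟ t)

#-↑ : ∀ m {n} (p : Fin (m + n) → Bool) → # p ≡ # (p ∘ (_↑ˡ n)) + # (p ∘ (m ↑ʳ_))
#-↑ m {n} p = begin
  # p                                            ≡⟨ #≡sum p ⟩
  sum (𝟙 ∘ p)                                    ≡⟨ sum-↑ m (𝟙 ∘ p) ⟩
  sum (𝟙 ∘ p ∘ (_↑ˡ n)) + sum (𝟙 ∘ p ∘ (m ↑ʳ_))
    ≡⟨ cong₂ _+_ (#≡sum (p ∘ (_↑ˡ n))) (#≡sum (p ∘ (m ↑ʳ_))) ⟨
  # (p ∘ (_↑ˡ n)) + # (p ∘ (m ↑ʳ_))              ∎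
  where open ≡-Reasoning

#-↑-left : ∀ m {n} {p : Fin (m + n) → Bool} {q : Fin m → Bool} →
           (∀ s → p (s ↑ˡ n) ≡ q s) → (∀ k → p (m ↑ʳ k) ≡ false) → # p ≡ # q
#-↑-left m {n} {p} {q} onLeft offRight = begin
  # p                                ≡⟨ #-↑ m p ⟩
  # (p ∘ (_↑ˡ n)) + # (p ∘ (m ↑ʳ_))  ≡⟨ cong₂ _+_ (#-cong onLeft) (#-none (p ∘ (m ↑ʳ_)) offRight) ⟩
  # q + 0                            ≡⟨ +-identityʳ (# q) ⟩
  # q                                ∎
  where open ≡-Reasoning

#-↑-right : ∀ m {n} {p : Fin (m + n) → Bool} {q : Fin n → Bool} →
            (∀ s → p (s ↑ˡ n) ≡ false) → (∀ k → p (m ↑ʳ k) ≡ q k) → # p ≡ # q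
#-↑-right m {n} {p} {q} offLeft onRight = begin
  # p                                ≡⟨ #-↑ m p ⟩
  # (p ∘ (_↑ˡ n)) + # (p ∘ (m ↑ʳ_))  ≡⟨ cong₂ _+_ (#-none (p ∘ (_↑ˡ n)) offLeft) (#-cong onRight) ⟩
  # q                                ∎
  where open ≡-Reasoning

occurs-reflects : ∀ {n v} (f : Fin n → Fin v) s → Reflects (∃[ k ] f k ≡ s) (occurs f s)
occurs-reflects f s = fromEquivalence
  (λ t → let k , e = tabulate⁻ (any⁻ _ _ t) in k , toWitness e)
  (λ (k , e) → any⁺ _ (tabulate⁺ k (fromWitness e)))

occurs-true : ∀ {n v} (f : Fin n → Fin v) {s} k → f k ≡ s → occurs f s ≡ true
occurs-true f {s} k fk≡s = det (occurs-reflects f s) (ofʸ (k , fk≡s))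

occurs-false : ∀ {n v} (f : Fin n → Fin v) {s} → (∀ k → f k ≢ s) → occurs f s ≡ false
occurs-false f {s} never = det (occurs-reflects f s) (ofⁿ λ (k , fk≡s) → never k fk≡s)

occurs-⇔ : ∀ {m n v w} (f : Fin m → Fin v) {s} (g : Fin n → Fin w) {t} →
           (∃[ k ] f k ≡ s → ∃[ k ] g k ≡ t) → (∃[ k ] g k ≡ t → ∃[ k ] f k ≡ s) →
           occurs f s ≡ occurs g t
occurs-⇔ f g {t} to from with occurs g t | occurs-reflects g t
... | true  | ofʸ g∋t = occurs-true f _ (proj₂ (from g∋t))
... | false | ofⁿ g∌t = occurs-false f λ k fk≡s → g∌t (to (k , fk≡s))

#preimage≡𝟙occurs : ∀ {n v} (f : Fin n → Fin v) → (∀ a b → f a ≡ f b → a ≡ b) →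
                      ∀ s → # (λ k → ⌊ f k ≟ s ⌋) ≡ 𝟙 (occurs f s)
#preimage≡𝟙occurs f inj s with occurs f s | occurs-reflects f s
... | true  | ofʸ (t , ft≡s) = trans (#-cong λ k → ⌊⌋-⇔ (preimage k) (f k ≟ s) (k ≟ t)) (#-≟ t)
  where
  preimage : ∀ k → (f k ≡ s) ⇔ (k ≡ t)
  preimage k = mk⇔ (λ fk≡s → inj k t (trans fk≡s (sym ft≡s))) (λ { refl → ft≡s })
... | false | ofⁿ ∄k        = #-none _ (λ k → ⌊⌋-false (f k ≟ s) (λ fk≡s → ∄k (k , fk≡s)))

-- Binomial coefficients C(n, 2)

[1+n]C2≡n+nC2 : ∀ n → suc n C 2 ≡ n + n C 2
[1+n]C2≡n+nC2 n = trans (sym (nCk+nC[k+1]≡[n+1]C[k+1] n 1)) (cong (_+ n C 2) (nC1≡n n))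

[n+1]C2≡nC2+n : ∀ n → (n + 1) C 2 ≡ n C 2 + n
[n+1]C2≡nC2+n n = trans (cong (_C 2) (+-comm n 1)) (trans ([1+n]C2≡n+nC2 n) (+-comm n (n C 2)))

[𝟙b+n]C2≡𝟙b*n+nC2 : ∀ b n → (𝟙 b + n) C 2 ≡ 𝟙 b * n + n C 2
[𝟙b+n]C2≡𝟙b*n+nC2 false n = refl
[𝟙b+n]C2≡𝟙b*n+nC2 true  n = trans ([1+n]C2≡n+nC2 n) (cong (_+ n C 2) (sym (*-identityˡ n)))

2*nC2≡n*[n∸1] : ∀ n → 2 * (n C 2) ≡ n * (n ∸ 1)
2*nC2≡n*[n∸1] zero          = refl
2*nC2≡n*[n∸1] (suc zero)    = refl
2*nC2≡n*[n∸1] (suc (suc n)) = begin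
  2 * (suc (suc n) C 2)           ≡⟨ cong (2 *_) ([1+n]C2≡n+nC2 (suc n)) ⟩
  2 * (suc n + suc n C 2)         ≡⟨ *-distribˡ-+ 2 (suc n) (suc n C 2) ⟩
  2 * suc n + 2 * (suc n C 2)     ≡⟨ cong (2 * suc n +_) (2*nC2≡n*[n∸1] (suc n)) ⟩
  2 * suc n + suc n * n           ≡⟨ expand n ⟩
  suc (suc n) * suc n             ∎
  where
  open ≡-Reasoning
  expand : ∀ n → 2 * suc n + suc n * n ≡ suc (suc n) * suc n
  expand = solve-∀

0<nC2 : ∀ {n} → 2 ≤ n → 0 < n C 2
0<nC2 {suc (suc n)} (s≤s (s≤s _)) = subst (0 <_) (sym ([1+n]C2≡n+nC2 (suc n))) z<s

n≤1⇒nC2≡0 : ∀ {n} → n ≤ 1 → n C 2 ≡ 0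
n≤1⇒nC2≡0 z≤n       = refl
n≤1⇒nC2≡0 (s≤s z≤n) = refl

nC2+1≡n : ∀ {n} → 0 < n → n ≤ 2 → n C 2 + 1 ≡ n
nC2+1≡n {1} _ _                       = refl
nC2+1≡n {2} _ _                       = refl
nC2+1≡n {suc (suc (suc _))} _ (s≤s (s≤s ()))

-- Double counting in families of sets

degree : ∀ {m v} → (Fin m → Fin v → Bool) → Fin v → ℕ
degree X s = sum (λ i → 𝟙 (X i s))

sumIntersections : ∀ {m n v} (X : Fin m → Fin v → Bool) (Y : Fin n → Fin v → Bool) →
  Σ[ (λ i → Σ[ (λ j → # (λ s → X i s ∧ Y j s)) ]) ] ≡ sum (λ s → degree X s * degree Y s)
sumIntersections {m} {n} {v} X Y = begin
  Σ[ (λ i → Σ[ (λ j → # (X∩Y i j)) ]) ]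
    ≡⟨ Σ²≡sum² (λ i j → # (X∩Y i j)) ⟩
  ∑[ i < m ] ∑[ j < n ] # (X∩Y i j)
    ≡⟨ sum-cong-≗ (λ i → sum-cong-≗ λ j → trans (#≡sum (X∩Y i j)) (sum-cong-≗ λ s → 𝟙-∧ (X i s) (Y j s))) ⟩
  ∑[ i < m ] ∑[ j < n ] ∑[ s < v ] (𝟙 (X i s) * 𝟙 (Y j s))
    ≡⟨ sum-cong-≗ (λ i → ∑-comm (λ j s → 𝟙 (X i s) * 𝟙 (Y j s))) ⟩
  ∑[ i < m ] ∑[ s < v ] ∑[ j < n ] (𝟙 (X i s) * 𝟙 (Y j s))
    ≡⟨ ∑-comm (λ i s → ∑[ j < n ] (𝟙 (X i s) * 𝟙 (Y j s))) ⟩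
  ∑[ s < v ] ∑[ i < m ] ∑[ j < n ] (𝟙 (X i s) * 𝟙 (Y j s))
    ≡⟨ sum-cong-≗ (λ s → sum-cong-≗ λ i → *-distribˡ-sum (𝟙 (X i s)) (λ j → 𝟙 (Y j s))) ⟨
  ∑[ s < v ] ∑[ i < m ] (𝟙 (X i s) * degree Y s)
    ≡⟨ sum-cong-≗ (λ s → *-distribʳ-sum (degree Y s) (λ i → 𝟙 (X i s))) ⟨
  ∑[ s < v ] (degree X s * degree Y s)
    ∎
  where
  open ≡-Reasoning
  X∩Y : Fin m → Fin n → Fin v → Bool
  X∩Y i j s = X i s ∧ Y j s

orderedPairs≡C2 : ∀ {m} (a : Fin m → Bool) →
  ∑[ i < m ] ∑[ i' < m ] (𝟙 ⌊ toℕ i <? toℕ i' ⌋ * 𝟙 (a i ∧ a i')) ≡ sum (𝟙 ∘ a) C 2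
orderedPairs≡C2 {zero}  a = refl
orderedPairs≡C2 {suc m} a = begin
  ∑[ i' < m ] (1 * 𝟙 (a zero ∧ a (suc i')))
    + ∑[ i < m ] ∑[ i' < m ] (𝟙 ⌊ suc (toℕ i) <? suc (toℕ i') ⌋ * 𝟙 (a (suc i) ∧ a (suc i')))
      ≡⟨ cong₂ _+_ firstRow (sum-cong-≗ λ i → sum-cong-≗ λ i' →
           cong (λ b → 𝟙 b * 𝟙 (a (suc i) ∧ a (suc i'))) (<?-suc (toℕ i) (toℕ i'))) ⟩
  𝟙 (a zero) * sum (𝟙 ∘ a ∘ suc)
    + ∑[ i < m ] ∑[ i' < m ] (𝟙 ⌊ toℕ i <? toℕ i' ⌋ * 𝟙 (a (suc i) ∧ a (suc i')))
      ≡⟨ cong (𝟙 (a zero) * sum (𝟙 ∘ a ∘ suc) +_) (orderedPairs≡C2 (a ∘ suc)) ⟩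
  𝟙 (a zero) * sum (𝟙 ∘ a ∘ suc) + sum (𝟙 ∘ a ∘ suc) C 2
      ≡⟨ [𝟙b+n]C2≡𝟙b*n+nC2 (a zero) (sum (𝟙 ∘ a ∘ suc)) ⟨
  sum (𝟙 ∘ a) C 2 ∎
  where
  open ≡-Reasoning
  firstRow : ∑[ i' < m ] (1 * 𝟙 (a zero ∧ a (suc i'))) ≡ 𝟙 (a zero) * sum (𝟙 ∘ a ∘ suc)
  firstRow = trans (sum-cong-≗ λ i' → trans (*-identityˡ _) (𝟙-∧ (a zero) (a (suc i'))))
                   (sym (*-distribˡ-sum (𝟙 (a zero)) (𝟙 ∘ a ∘ suc)))

sumPairIntersections : ∀ {m v} (X : Fin m → Fin v → Bool) →
  Σ[ (λ i → Σ[ (λ i' → if ⌊ toℕ i <? toℕ i' ⌋ then # (λ s → X i s ∧ X i' s) else 0) ]) ]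
    ≡ sum (λ s → degree X s C 2)
sumPairIntersections {m} {v} X = begin
  Σ[ (λ i → Σ[ (λ i' → if i<i' i i' then # (∩ i i') else 0) ]) ]
    ≡⟨ Σ²≡sum² (λ i i' → if i<i' i i' then # (∩ i i') else 0) ⟩
  ∑[ i < m ] ∑[ i' < m ] (if i<i' i i' then # (∩ i i') else 0)
    ≡⟨ sum-cong-≗ (λ i → sum-cong-≗ λ i' → distribute i i') ⟩
  ∑[ i < m ] ∑[ i' < m ] ∑[ s < v ] (𝟙 (i<i' i i') * 𝟙 (∩ i i' s))
    ≡⟨ sum-cong-≗ (λ i → ∑-comm λ i' s → 𝟙 (i<i' i i') * 𝟙 (∩ i i' s)) ⟩
  ∑[ i < m ] ∑[ s < v ] ∑[ i' < m ] (𝟙 (i<i' i i') * 𝟙 (∩ i i' s))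
    ≡⟨ ∑-comm (λ i s → ∑[ i' < m ] (𝟙 (i<i' i i') * 𝟙 (∩ i i' s))) ⟩
  ∑[ s < v ] ∑[ i < m ] ∑[ i' < m ] (𝟙 (i<i' i i') * 𝟙 (∩ i i' s))
    ≡⟨ sum-cong-≗ (λ s → orderedPairs≡C2 (λ i → X i s)) ⟩
  ∑[ s < v ] (degree X s C 2)
    ∎
  where
  open ≡-Reasoning
  i<i' : Fin m → Fin m → Bool
  i<i' i i' = ⌊ toℕ i <? toℕ i' ⌋
  ∩ : Fin m → Fin m → Fin v → Bool
  ∩ i i' s = X i s ∧ X i' s
  distribute : ∀ i i' →
               (if i<i' i i' then # (∩ i i') else 0) ≡ ∑[ s < v ] (𝟙 (i<i' i i') * 𝟙 (∩ i i' s))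
  distribute i i' = begin
    (if i<i' i i' then # (∩ i i') else 0)  ≡⟨ if-then-0 (i<i' i i') (# (∩ i i')) ⟩
    𝟙 (i<i' i i') * # (∩ i i')             ≡⟨ cong (𝟙 (i<i' i i') *_) (#≡sum (∩ i i')) ⟩
    𝟙 (i<i' i i') * sum (𝟙 ∘ ∩ i i')       ≡⟨ *-distribˡ-sum (𝟙 (i<i' i i')) (𝟙 ∘ ∩ i i') ⟩
    ∑[ s < v ] (𝟙 (i<i' i i') * 𝟙 (∩ i i' s)) ∎

module _ {r c v} (T : Design r c v) where

  repl≡sum² : ∀ s → repl T s ≡ ∑[ i < r ] ∑[ j < c ] 𝟙 ⌊ T i j ≟ s ⌋
  repl≡sum² s = trans (Σ≡sum (λ i → # (λ j → ⌊ T i j ≟ s ⌋)))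
                      (sum-cong-≗ λ i → #≡sum (λ j → ⌊ T i j ≟ s ⌋))

  sum-repl : sum (repl T) ≡ r * c
  sum-repl = begin
    ∑[ s < v ] repl T s                               ≡⟨ sum-cong-≗ repl≡sum² ⟩
    ∑[ s < v ] ∑[ i < r ] ∑[ j < c ] 𝟙 ⌊ T i j ≟ s ⌋
      ≡⟨ ∑-comm (λ s i → ∑[ j < c ] 𝟙 ⌊ T i j ≟ s ⌋) ⟩
    ∑[ i < r ] ∑[ s < v ] ∑[ j < c ] 𝟙 ⌊ T i j ≟ s ⌋
      ≡⟨ sum-cong-≗ (λ i → ∑-comm λ s j → 𝟙 ⌊ T i j ≟ s ⌋) ⟩
    ∑[ i < r ] ∑[ j < c ] ∑[ s < v ] 𝟙 ⌊ T i j ≟ s ⌋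
      ≡⟨ sum-cong-≗ (λ i → sum-cong-≗ λ j → occursOnce (T i j)) ⟩
    ∑[ i < r ] ∑[ j < c ] 1                           ≡⟨ sum-cong-≗ {r} (λ i → trans (sum-const c 1) (*-identityʳ c)) ⟩
    ∑[ i < r ] c                                      ≡⟨ sum-const r c ⟩
    r * c                                             ∎
    where
    open ≡-Reasoning
    occursOnce : ∀ t → ∑[ s < v ] 𝟙 ⌊ t ≟ s ⌋ ≡ 1
    occursOnce t = trans (sym (#≡sum (λ s → ⌊ t ≟ s ⌋))) (#-≟′ t)

  module _ (binary : Binary T) where

    rowDegree : ∀ s → degree (Row T) s ≡ repl T s
    rowDegree s = sym (trans (Σ≡sum (λ i → # (λ j → ⌊ T i j ≟ s ⌋)))
                             (sum-cong-≗ λ i → #preimage≡𝟙occurs (T i) (proj₁ binary i) s))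

    colDegree : ∀ s → degree (Col T) s ≡ repl T s
    colDegree s = sym (begin
      repl T s                                  ≡⟨ repl≡sum² s ⟩
      ∑[ i < r ] ∑[ j < c ] 𝟙 ⌊ T i j ≟ s ⌋     ≡⟨ ∑-comm (λ i j → 𝟙 ⌊ T i j ≟ s ⌋) ⟩
      ∑[ j < c ] ∑[ i < r ] 𝟙 ⌊ T i j ≟ s ⌋     ≡⟨ sum-cong-≗ (λ j → #≡sum (λ i → ⌊ T i j ≟ s ⌋)) ⟨
      ∑[ j < c ] # (λ i → ⌊ T i j ≟ s ⌋)
        ≡⟨ sum-cong-≗ (λ j → #preimage≡𝟙occurs (λ i → T i j) (λ i i' → proj₂ binary i i' j) s) ⟩
      degree (Col T) s                          ∎)
      where open ≡-Reasoning

    sumRC≡sum-repl² : sumRC T ≡ sum (λ s → repl T s * repl T s)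
    sumRC≡sum-repl² = trans (sumIntersections (Row T) (Col T))
                            (sum-cong-≗ λ s → cong₂ _*_ (rowDegree s) (colDegree s))

    sumRR≡sum-replC2 : sumRR T ≡ sum (λ s → repl T s C 2)
    sumRR≡sum-replC2 = trans (sumPairIntersections (Row T)) (sum-cong-≗ λ s → cong (_C 2) (rowDegree s))

    sumCC≡sum-replC2 : sumCC T ≡ sum (λ s → repl T s C 2)
    sumCC≡sum-replC2 = trans (sumPairIntersections (Col T)) (sum-cong-≗ λ s → cong (_C 2) (colDegree s))

-- Appending a column

data SplitView (m n : ℕ) : Fin (m + n) → Set where
  left  : (i : Fin m) → SplitView m n (i ↑ˡ n)
  right : (k : Fin n) → SplitView m n (m ↑ʳ k)

splitView : ∀ m n (j : Fin (m + n)) → SplitView m n j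
splitView m n j with splitAt m j | join-splitAt m n j
... | inj₁ i | refl = left i
... | inj₂ k | refl = right k

↑ˡ≢↑ʳ : ∀ {m n} (i : Fin m) (k : Fin n) → i ↑ˡ n ≢ m ↑ʳ k
↑ˡ≢↑ʳ {m} {n} i k eq with () ← trans (sym (splitAt-↑ˡ m i n)) (trans (cong (splitAt m) eq) (splitAt-↑ʳ m n k))

module AppendColumn {r c v} (T : Design r c v) where

  T⁺ : Design r (c + 1) (v + r)
  T⁺ = appendColumn T

  last : Fin (c + 1)
  last = c ↑ʳ zero

  T⁺-old : ∀ i j → T⁺ i (j ↑ˡ 1) ≡ T i j ↑ˡ r
  T⁺-old i j rewrite splitAt-↑ˡ c j 1 = refl

  T⁺-new : ∀ i k → T⁺ i (c ↑ʳ k) ≡ v ↑ʳ i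
  T⁺-new i k rewrite splitAt-↑ʳ c 1 k = refl

  old-symbol-cell : ∀ {i j' s} → T⁺ i j' ≡ s ↑ˡ r → ∃[ j ] j' ≡ j ↑ˡ 1 × T i j ≡ s
  old-symbol-cell {i} {j'} eq with splitView c 1 j'
  ... | left j  = j , refl , ↑ˡ-injective r _ _ (trans (sym (T⁺-old i j)) eq)
  ... | right k = ⊥-elim (↑ˡ≢↑ʳ _ i (sym (trans (sym (T⁺-new i k)) eq)))

  new-symbol-cell : ∀ {i j' k} → T⁺ i j' ≡ v ↑ʳ k → i ≡ k
  new-symbol-cell {i} {j'} eq with splitView c 1 j'
  ... | left j  = ⊥-elim (↑ˡ≢↑ʳ _ _ (trans (sym (T⁺-old i j)) eq))
  ... | right k = ↑ʳ-injective v _ _ (trans (sym (T⁺-new i k)) eq)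

  Row-old : ∀ i s → Row T⁺ i (s ↑ˡ r) ≡ Row T i s
  Row-old i s = occurs-⇔ (T⁺ i) (T i)
    (λ (j' , eq) → let j , _ , Tij≡s = old-symbol-cell eq in j , Tij≡s)
    (λ (j , Tij≡s) → j ↑ˡ 1 , trans (T⁺-old i j) (cong (_↑ˡ r) Tij≡s))

  Row-new : ∀ i k → Row T⁺ i (v ↑ʳ k) ≡ ⌊ i ≟ k ⌋
  Row-new i k with i ≟ k
  ... | yes refl = occurs-true (T⁺ i) last (T⁺-new i zero)
  ... | no  i≢k  = occurs-false (T⁺ i) (λ j' → i≢k ∘ new-symbol-cell)

  Col-old-old : ∀ j s → Col T⁺ (j ↑ˡ 1) (s ↑ˡ r) ≡ Col T j s
  Col-old-old j s = occurs-⇔ (λ i → T⁺ i (j ↑ˡ 1)) (λ i → T i j)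
    (λ (i , eq) → i , ↑ˡ-injective r _ _ (trans (sym (T⁺-old i j)) eq))
    (λ (i , Tij≡s) → i , trans (T⁺-old i j) (cong (_↑ˡ r) Tij≡s))

  Col-old-new : ∀ j k → Col T⁺ (j ↑ˡ 1) (v ↑ʳ k) ≡ false
  Col-old-new j k = occurs-false (λ i → T⁺ i (j ↑ˡ 1)) (λ i → ↑ˡ≢↑ʳ _ _ ∘ trans (sym (T⁺-old i j)))

  Col-new-old : ∀ s → Col T⁺ last (s ↑ˡ r) ≡ false
  Col-new-old s = occurs-false (λ i → T⁺ i last) (λ i eq → ↑ˡ≢↑ʳ _ _ (trans (sym eq) (T⁺-new i zero)))

  Col-new-new : ∀ k → Col T⁺ last (v ↑ʳ k) ≡ true
  Col-new-new k = occurs-true (λ i → T⁺ i last) k (T⁺-new k zero)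

  binary⁺ : Binary T → Binary T⁺
  binary⁺ (rowInj , colInj) = rowInj⁺ , colInj⁺
    where
    rowInj⁺ : ∀ i j j' → T⁺ i j ≡ T⁺ i j' → j ≡ j'
    rowInj⁺ i j j' eq with splitView c 1 j
    ... | left a with b , refl , Tib≡Tia ← old-symbol-cell (trans (sym eq) (T⁺-old i a))
       = cong (_↑ˡ 1) (rowInj i a b (sym Tib≡Tia))
    ... | right zero with splitView c 1 j'
    ...   | left b       = ⊥-elim (↑ˡ≢↑ʳ _ _ (trans (sym (T⁺-old i b)) (trans (sym eq) (T⁺-new i zero))))
    ...   | right zero   = refl
    colInj⁺ : ∀ i i' j → T⁺ i j ≡ T⁺ i' j → i ≡ i'
    colInj⁺ i i' j eq with splitView c 1 j
    ... | left a  = colInj i i' a (↑ˡ-injective r _ _ (trans (sym (T⁺-old i a)) (trans eq (T⁺-old i' a))))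
    ... | right k = ↑ʳ-injective v _ _ (trans (sym (T⁺-new i k)) (trans eq (T⁺-new i' k)))

  rowCol-old : ∀ i j → rowCol T⁺ i (j ↑ˡ 1) ≡ rowCol T i j
  rowCol-old i j = #-↑-left v
    (λ s → cong₂ _∧_ (Row-old i s) (Col-old-old j s))
    (λ k → trans (cong (Row T⁺ i (v ↑ʳ k) ∧_) (Col-old-new j k)) (∧-zeroʳ _))

  rowCol-new : ∀ i → rowCol T⁺ i last ≡ 1
  rowCol-new i = trans (#-↑-right v
    (λ s → trans (cong (Row T⁺ i (s ↑ˡ r) ∧_) (Col-new-old s)) (∧-zeroʳ _))
    (λ k → trans (cong₂ _∧_ (Row-new i k) (Col-new-new k)) (∧-identityʳ _)))
    (#-≟′ i)

  rowRow-old : ∀ i i' → i ≢ i' → rowRow T⁺ i i' ≡ rowRow T i i'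
  rowRow-old i i' i≢i' = #-↑-left v
    (λ s → cong₂ _∧_ (Row-old i s) (Row-old i' s))
    (λ k → trans (cong₂ _∧_ (Row-new i k) (Row-new i' k)) (notBoth k))
    where
    notBoth : ∀ k → ⌊ i ≟ k ⌋ ∧ ⌊ i' ≟ k ⌋ ≡ false
    notBoth k with i ≟ k | i' ≟ k
    ... | yes refl | yes refl = ⊥-elim (i≢i' refl)
    ... | yes _    | no _     = refl
    ... | no _     | _        = refl

  colCol-old : ∀ j j' → colCol T⁺ (j ↑ˡ 1) (j' ↑ˡ 1) ≡ colCol T j j'
  colCol-old j j' = #-↑-left v
    (λ s → cong₂ _∧_ (Col-old-old j s) (Col-old-old j' s))
    (λ k → cong₂ _∧_ (Col-old-new j k) (Col-old-new j' k))

  colCol-old-new : ∀ j → colCol T⁺ (j ↑ˡ 1) last ≡ 0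
  colCol-old-new j = #-none _ disjoint
    where
    disjoint : ∀ s' → Col T⁺ (j ↑ˡ 1) s' ∧ Col T⁺ last s' ≡ false
    disjoint s' with splitView v r s'
    ... | left s  = trans (cong (Col T⁺ (j ↑ˡ 1) (s ↑ˡ r) ∧_) (Col-new-old s)) (∧-zeroʳ _)
    ... | right k = cong (_∧ Col T⁺ last (v ↑ʳ k)) (Col-old-new j k)

  colCol-new-old : ∀ j → colCol T⁺ last (j ↑ˡ 1) ≡ 0
  colCol-new-old j = trans (#-cong λ s' → ∧-comm (Col T⁺ last s') (Col T⁺ (j ↑ˡ 1) s')) (colCol-old-new j)

  module _ (binary : Binary T) where

    repl-old : ∀ s → repl T⁺ (s ↑ˡ r) ≡ repl T s
    repl-old s = begin
      repl T⁺ (s ↑ˡ r)          ≡⟨ rowDegree T⁺ (binary⁺ binary) (s ↑ˡ r) ⟨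
      degree (Row T⁺) (s ↑ˡ r)  ≡⟨ sum-cong-≗ (λ i → cong 𝟙 (Row-old i s)) ⟩
      degree (Row T) s          ≡⟨ rowDegree T binary s ⟩
      repl T s                  ∎
      where open ≡-Reasoning

    repl-new : ∀ k → repl T⁺ (v ↑ʳ k) ≡ 1
    repl-new k = begin
      repl T⁺ (v ↑ʳ k)          ≡⟨ rowDegree T⁺ (binary⁺ binary) (v ↑ʳ k) ⟨
      degree (Row T⁺) (v ↑ʳ k)  ≡⟨ sum-cong-≗ (λ i → cong 𝟙 (Row-new i k)) ⟩
      sum (λ i → 𝟙 ⌊ i ≟ k ⌋)   ≡⟨ #≡sum (λ i → ⌊ i ≟ k ⌋) ⟨
      # (λ i → ⌊ i ≟ k ⌋)       ≡⟨ #-≟ k ⟩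
      1                         ∎
      where open ≡-Reasoning

    sumRC-append : sumRC T⁺ ≡ sumRC T + r
    sumRC-append = begin
      sumRC T⁺                                ≡⟨ sumRC≡sum-repl² T⁺ (binary⁺ binary) ⟩
      sum (λ s' → repl T⁺ s' * repl T⁺ s')    ≡⟨ sum-↑ v (λ s' → repl T⁺ s' * repl T⁺ s') ⟩
      ∑[ s < v ] (repl T⁺ (s ↑ˡ r) * repl T⁺ (s ↑ˡ r)) + ∑[ k < r ] (repl T⁺ (v ↑ʳ k) * repl T⁺ (v ↑ʳ k))
        ≡⟨ cong₂ _+_ (sum-cong-≗ λ s → cong₂ _*_ (repl-old s) (repl-old s))
                     (sum-cong-≗ λ k → cong₂ _*_ (repl-new k) (repl-new k)) ⟩
      ∑[ s < v ] (repl T s * repl T s) + ∑[ k < r ] 1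
        ≡⟨ cong₂ _+_ (sym (sumRC≡sum-repl² T binary)) (trans (sum-const r 1) (*-identityʳ r)) ⟩
      sumRC T + r                             ∎
      where open ≡-Reasoning

    sum-replC2-append : sum (λ s' → repl T⁺ s' C 2) ≡ sum (λ s → repl T s C 2)
    sum-replC2-append = begin
      sum (λ s' → repl T⁺ s' C 2)     ≡⟨ sum-↑ v (λ s' → repl T⁺ s' C 2) ⟩
      ∑[ s < v ] (repl T⁺ (s ↑ˡ r) C 2) + ∑[ k < r ] (repl T⁺ (v ↑ʳ k) C 2)
        ≡⟨ cong₂ _+_ (sum-cong-≗ λ s → cong (_C 2) (repl-old s))
                     (sum-cong-≗ λ k → cong (_C 2) (repl-new k)) ⟩
      ∑[ s < v ] (repl T s C 2) + ∑[ k < r ] 0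
        ≡⟨ cong (sum (λ s → repl T s C 2) +_) (sum-replicate-zero r) ⟩
      ∑[ s < v ] (repl T s C 2) + 0   ≡⟨ +-identityʳ _ ⟩
      sum (λ s → repl T s C 2)        ∎
      where open ≡-Reasoning

    sumRR-append : sumRR T⁺ ≡ sumRR T
    sumRR-append = trans (sumRR≡sum-replC2 T⁺ (binary⁺ binary))
                         (trans sum-replC2-append (sym (sumRR≡sum-replC2 T binary)))

    sumCC-append : sumCC T⁺ ≡ sumCC T
    sumCC-append = trans (sumCC≡sum-replC2 T⁺ (binary⁺ binary))
                         (trans sum-replC2-append (sym (sumCC≡sum-replC2 T binary)))

-- Floors and ceilings

WithinOne : ℕ → ℕ → ℕ → Set
WithinOne k N D = k * D < N + D × N < k * D + D

floor-upper : ∀ N D .{{_ : NonZero D}} → N < N / D * D + D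
floor-upper N D = begin-strict
  N                      ≡⟨ m≡m%n+[m/n]*n N D ⟩
  N % D + N / D * D      <⟨ +-monoˡ-< (N / D * D) (m%n<n N D) ⟩
  D + N / D * D          ≡⟨ +-comm D (N / D * D) ⟩
  N / D * D + D          ∎
  where open ≤-Reasoning

/-unique : ∀ {m q} D .{{_ : NonZero D}} → q * D ≤ m → m < q * D + D → m / D ≡ q
/-unique {m} {q} D qD≤m m<qD+D = ≤-antisym
  (s≤s⁻¹ (m<n*o⇒m/o<n (subst (m <_) (+-comm (q * D) D) m<qD+D)))
  (subst (_≤ m / D) (m*n/n≡m q D) (/-monoˡ-≤ D qD≤m))

floorOrCeil⇒withinOne : ∀ {k N D} → 0 < D → FloorOrCeil k N D → WithinOne k N D
floorOrCeil⇒withinOne {N = N} {suc d} _ (inj₁ refl) =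
  ≤-<-trans (m/n*n≤m N (suc d)) (m<m+n N z<s) , floor-upper N (suc d)
floorOrCeil⇒withinOne {N = N} {suc d} _ (inj₂ refl) =
  ≤-<-trans (m/n*n≤m (N + d) (suc d)) (+-monoʳ-< N (n<1+n d)) ,
  ≤-<-trans (m≤m+n N d) (floor-upper (N + d) (suc d))

withinOne⇒floorOrCeil : ∀ {k N D} → 0 < D → WithinOne k N D → FloorOrCeil k N D
withinOne⇒floorOrCeil {k} {N} {suc d} _ (lower , upper) with k * suc d ≤? N
... | yes kD≤N = inj₁ (sym (/-unique (suc d) kD≤N upper))
... | no  kD≰N = inj₂ (sym (/-unique (suc d) (s≤s⁻¹ (subst (k * suc d <_) (+-suc N d) lower))
                                             (<-≤-trans (+-monoˡ-< d (≰⇒> kD≰N)) (+-monoʳ-≤ (k * suc d) (n≤1+n d)))))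

withinOne⇒≤ : ∀ {k N D} m → N ≤ m * D → WithinOne k N D → k ≤ m
withinOne⇒≤ {k} {N} {D} m N≤mD (lower , _) = s≤s⁻¹ (*-cancelʳ-< D k (suc m) (begin-strict
  k * D      <⟨ lower ⟩
  N + D      ≤⟨ +-monoˡ-≤ D N≤mD ⟩
  m * D + D  ≡⟨ +-comm (m * D) D ⟩
  suc m * D  ∎))
  where open ≤-Reasoning

withinOne⇒positive : ∀ {k N D} → D ≤ N → WithinOne k N D → 0 < k
withinOne⇒positive {zero}  D≤N (_ , N<D) = contradiction N<D (≤⇒≯ D≤N)
withinOne⇒positive {suc k} _   _         = z<s

withinOne-mediant : ∀ {k N D A E} → WithinOne k N D → k * E ≤ A + E → A ≤ k * E + E →
                    WithinOne k (N + A) (D + E)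
withinOne-mediant {k} {N} {D} {A} {E} (lower , upper) kE≤A+E A≤kE+E =
  (begin-strict
    k * (D + E)          ≡⟨ *-distribˡ-+ k D E ⟩
    k * D + k * E        <⟨ +-mono-<-≤ lower kE≤A+E ⟩
    (N + D) + (A + E)    ≡⟨ interchange N D A E ⟩
    (N + A) + (D + E)    ∎) ,
  (begin-strict
    N + A                        <⟨ +-mono-<-≤ upper A≤kE+E ⟩
    (k * D + D) + (k * E + E)    ≡⟨ interchange (k * D) D (k * E) E ⟩
    (k * D + k * E) + (D + E)    ≡⟨ cong (_+ (D + E)) (*-distribˡ-+ k D E) ⟨
    k * (D + E) + (D + E)        ∎)
  where open ≤-Reasoning

1-withinOne : ∀ {N D} → 0 < N → N < 2 * D → WithinOne 1 N D
1-withinOne {N} {D} 0<N N<2D =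
  subst (_< N + D) (sym (*-identityˡ D)) (+-monoˡ-< D 0<N) ,
  subst (N <_) (cong (_+ D) (sym (*-identityˡ D))) (subst (N <_) (cong (D +_) (+-identityʳ D)) N<2D)

0-withinOne : ∀ {N D} → N < D → WithinOne 0 N D
0-withinOne {N} {D} N<D = <-≤-trans (≤-<-trans z≤n N<D) (m≤n+m D N) , N<D

floorOrCeil⇒≤ : ∀ {k N D} m → 0 < D → N ≤ m * D → FloorOrCeil k N D → k ≤ m
floorOrCeil⇒≤ m 0<D N≤mD = withinOne⇒≤ m N≤mD ∘ floorOrCeil⇒withinOne 0<D

floorOrCeil⇒positive : ∀ {k N D} → 0 < D → D ≤ N → FloorOrCeil k N D → 0 < k
floorOrCeil⇒positive 0<D D≤N = withinOne⇒positive D≤N ∘ floorOrCeil⇒withinOne 0<D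

floorOrCeil-addBoth : ∀ {k N D} R → 0 < D → N ≤ 2 * D → FloorOrCeil k N D → FloorOrCeil k (N + R) (D + R)
floorOrCeil-addBoth {k} {N} {D} R 0<D N≤2D k≈N/D =
  withinOne⇒floorOrCeil (<-≤-trans 0<D (m≤m+n D R))
    (withinOne-mediant {k} (floorOrCeil⇒withinOne 0<D k≈N/D) kR≤R+R (m≤n+m R (k * R)))
  where
  kR≤R+R : k * R ≤ R + R
  kR≤R+R = subst (k * R ≤_) (cong (R +_) (+-identityʳ R)) (*-monoˡ-≤ R (floorOrCeil⇒≤ 2 0<D N≤2D k≈N/D))

floorOrCeil-addDenominator : ∀ {k N D} E → 0 < D → N ≤ D → FloorOrCeil k N D → FloorOrCeil k N (D + E)
floorOrCeil-addDenominator {k} {N} {D} E 0<D N≤D k≈N/D =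
  subst (λ M → FloorOrCeil k M (D + E)) (+-identityʳ N)
    (withinOne⇒floorOrCeil (<-≤-trans 0<D (m≤m+n D E))
      (withinOne-mediant {k} (floorOrCeil⇒withinOne 0<D k≈N/D) kE≤E z≤n))
  where
  kE≤E : k * E ≤ 0 + E
  kE≤E = subst (k * E ≤_) (*-identityˡ E)
           (*-monoˡ-≤ E (floorOrCeil⇒≤ 1 0<D (subst (N ≤_) (sym (*-identityˡ D)) N≤D) k≈N/D))

floorOrCeil-1 : ∀ {N D} → 0 < N → N < 2 * D → FloorOrCeil 1 N D
floorOrCeil-1 {D = suc d} 0<N N<2D = withinOne⇒floorOrCeil z<s (1-withinOne 0<N N<2D)

floorOrCeil-1-addBoth : ∀ {N D R} → N ≤ 2 * D → 0 < R → FloorOrCeil 1 (N + R) (D + R)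
floorOrCeil-1-addBoth {N} {D} {R} N≤2D 0<R =
  floorOrCeil-1 {D = D + R} (<-≤-trans 0<R (m≤n+m R N)) (begin-strict
  N + R              <⟨ +-mono-≤-< N≤2D (m<m+n R 0<R) ⟩
  2 * D + (R + R)    ≡⟨ cong (λ x → 2 * D + (R + x)) (+-identityʳ R) ⟨
  2 * D + 2 * R      ≡⟨ *-distribˡ-+ 2 D R ⟨
  2 * (D + R)        ∎)
  where open ≤-Reasoning

floorOrCeil-0 : ∀ {N D} → N < D → FloorOrCeil 0 N D
floorOrCeil-0 N<D = withinOne⇒floorOrCeil (≤-<-trans z≤n N<D) (0-withinOne N<D)

-- Near triple arrays

m*[n+1]≡m*n+m : ∀ m n → m * (n + 1) ≡ m * n + m
m*[n+1]≡m*n+m m n = trans (*-distribˡ-+ m n 1) (cong (m * n +_) (*-identityʳ m))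

module _ {r c v} {T : Design r c v} (nta : NearTripleArray r c v T) where
  open NearTripleArray nta
  open AppendColumn T

  private
    N : ℕ
    N = r * c

    0<r : 0 < r
    0<r = <-≤-trans z<s r≥2

    0<c : 0 < c
    0<c = <-≤-trans z<s c≥2

    0<v : 0 < v
    0<v = ≤-<-trans z≤n (toℕ<n (T (fromℕ< 0<r) (fromℕ< 0<c)))

    0<N : 0 < N
    0<N = *-mono-< 0<r 0<c

  replication-append : N ≤ 2 * v → ∀ s' → FloorOrCeil (repl T⁺ s') (r * (c + 1)) (v + r)
  replication-append N≤2v s' rewrite m*[n+1]≡m*n+m r c with splitView v r s'
  ... | left s  rewrite repl-old binary s = floorOrCeil-addBoth r 0<v N≤2v (replication s)
  ... | right k rewrite repl-new binary k = floorOrCeil-1-addBoth {D = v} N≤2v 0<r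

  rowColBal-append : sumRC T ≤ 2 * N →
                     ∀ i j' → FloorOrCeil (rowCol T⁺ i j') (sumRC T⁺) (r * (c + 1))
  rowColBal-append sumRC≤2N i j' rewrite m*[n+1]≡m*n+m r c | sumRC-append binary with splitView c 1 j'
  ... | left j     rewrite rowCol-old i j = floorOrCeil-addBoth r 0<N sumRC≤2N (rowColBal i j)
  ... | right zero rewrite rowCol-new i   = floorOrCeil-1-addBoth {D = N} sumRC≤2N 0<r

  rowRowBal-append : ∀ i i' → i ≢ i' → FloorOrCeil (rowRow T⁺ i i') (sumRR T⁺) (r C 2)
  rowRowBal-append i i' i≢i' rewrite rowRow-old i i' i≢i' | sumRR-append binary = rowRowBal i i' i≢i'

  colColBal-append : sumCC T ≤ c C 2 →
                     ∀ j j' → j ≢ j' → FloorOrCeil (colCol T⁺ j j') (sumCC T⁺) ((c + 1) C 2)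
  colColBal-append sumCC≤K j j' j≢j' rewrite [n+1]C2≡nC2+n c | sumCC-append binary
    with splitView c 1 j | splitView c 1 j'
  ... | left a     | left b     rewrite colCol-old a b =
    floorOrCeil-addDenominator c (0<nC2 c≥2) sumCC≤K (colColBal a b (j≢j' ∘ cong (_↑ˡ 1)))
  ... | left a     | right zero rewrite colCol-old-new a = floorOrCeil-0 (≤-<-trans sumCC≤K (m<m+n _ 0<c))
  ... | right zero | left b     rewrite colCol-new-old b = floorOrCeil-0 (≤-<-trans sumCC≤K (m<m+n _ 0<c))
  ... | right zero | right zero = ⊥-elim (j≢j' refl)

  module _ (balanced : 2 * N ∸ c * (r ⊓ (c ∸ 1)) ≤ 2 * v) where

    2N≤cm+2v : 2 * N ≤ c * (r ⊓ (c ∸ 1)) + 2 * v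
    2N≤cm+2v = ≤-trans (m≤n+m∸n (2 * N) (c * (r ⊓ (c ∸ 1)))) (+-monoʳ-≤ (c * (r ⊓ (c ∸ 1))) balanced)

    N≤2v : N ≤ 2 * v
    N≤2v = +-cancelˡ-≤ N N (2 * v) (begin
      N + N                        ≡⟨ cong (N +_) (+-identityʳ N) ⟨
      2 * N                        ≤⟨ 2N≤cm+2v ⟩
      c * (r ⊓ (c ∸ 1)) + 2 * v    ≤⟨ +-monoˡ-≤ (2 * v) (*-monoʳ-≤ c (m⊓n≤m r (c ∸ 1))) ⟩
      c * r + 2 * v                ≡⟨ cong (_+ 2 * v) (*-comm c r) ⟩
      N + 2 * v                    ∎)
      where open ≤-Reasoning

    repl≤2 : ∀ s → repl T s ≤ 2
    repl≤2 s = floorOrCeil⇒≤ 2 0<v N≤2v (replication s)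

    sumRC≤2N : sumRC T ≤ 2 * N
    sumRC≤2N = begin
      sumRC T                          ≡⟨ sumRC≡sum-repl² T binary ⟩
      sum (λ s → repl T s * repl T s)  ≤⟨ sum-mono-≤ (λ s → *-monoˡ-≤ (repl T s) (repl≤2 s)) ⟩
      sum (λ s → 2 * repl T s)         ≡⟨ *-distribˡ-sum 2 (repl T) ⟨
      2 * sum (repl T)                 ≡⟨ cong (2 *_) (sum-repl T) ⟩
      2 * N                            ∎
      where open ≤-Reasoning

    -- Either every symbol occurs at most once, or every symbol occurs once or twice,
    -- and then Σ C(e_s, 2) = Σ (e_s − 1) = rc − v.
    sumCC≤cC2 : sumCC T ≤ c C 2
    sumCC≤cC2 with v ≤? N
    ... | no v≰N = subst (_≤ c C 2) (sym (trans (sumCC≡sum-replC2 T binary) Q≡0)) z≤n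
      where
      N≤1*v : N ≤ 1 * v
      N≤1*v = ≤-trans (<⇒≤ (≰⇒> v≰N)) (≤-reflexive (sym (*-identityˡ v)))
      Q≡0 : sum (λ s → repl T s C 2) ≡ 0
      Q≡0 = trans (sum-cong-≗ λ s → n≤1⇒nC2≡0 (floorOrCeil⇒≤ 1 0<v N≤1*v (replication s)))
                  (sum-replicate-zero v)
    ... | yes v≤N = *-cancelˡ-≤ 2 (begin
      2 * sumCC T                  ≡⟨ cong (2 *_) (sumCC≡sum-replC2 T binary) ⟩
      2 * Q                        ≤⟨ +-cancelʳ-≤ (2 * v) (2 * Q) _ (begin
                                        2 * Q + 2 * v   ≡⟨ *-distribˡ-+ 2 Q v ⟨
                                        2 * (Q + v)     ≡⟨ cong (2 *_) Q+v≡N ⟩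
                                        2 * N           ≤⟨ 2N≤cm+2v ⟩
                                        c * (r ⊓ (c ∸ 1)) + 2 * v ∎) ⟩
      c * (r ⊓ (c ∸ 1))            ≤⟨ *-monoʳ-≤ c (m⊓n≤n r (c ∸ 1)) ⟩
      c * (c ∸ 1)                  ≡⟨ 2*nC2≡n*[n∸1] c ⟨
      2 * (c C 2)                  ∎)
      where
      open ≤-Reasoning
      Q : ℕ
      Q = sum (λ s → repl T s C 2)
      Q+v≡N : Q + v ≡ N
      Q+v≡N = begin-equality
        Q + v                              ≡⟨ cong (Q +_) (trans (sym (*-identityʳ v)) (sym (sum-const v 1))) ⟩
        Q + sum {v} (λ _ → 1)              ≡⟨ ∑-distrib-+ (λ s → repl T s C 2) (λ _ → 1) ⟨
        sum (λ s → repl T s C 2 + 1)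
          ≡⟨ sum-cong-≗ (λ s → nC2+1≡n (floorOrCeil⇒positive 0<v v≤N (replication s)) (repl≤2 s)) ⟩
        sum (repl T)                       ≡⟨ sum-repl T ⟩
        N                                  ∎

lemma5p3 : (r c v : ℕ) (T : Design r c v) →
    NearTripleArray r c v T →
    2 * (r * c) ∸ c * (r ⊓ (c ∸ 1)) ≤ 2 * v →
    NearTripleArray r (c + 1) (v + r) (appendColumn T)
lemma5p3 r c v T nta balanced = record
  { r≥2         = r≥2
  ; c≥2         = ≤-trans c≥2 (m≤m+n c 1)
  ; binary      = AppendColumn.binary⁺ T binary
  ; replication = replication-append nta (N≤2v nta balanced)
  ; rowColBal   = rowColBal-append nta (sumRC≤2N nta balanced)
  ; rowRowBal   = rowRowBal-append nta
  ; colColBal   = colColBal-append nta (sumCC≤cC2 nta balanced)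
  }
  where open NearTripleArray nta
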